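{- Let $f_2$ be the morphism on the alphabet $\{0,1,\dots,15\}$ (each number is a single letter) given by $0\mapsto 0\,1$, $1\mapsto 2$, $2\mapsto 3\,4$, $3\mapsto 5\,6$, $4\mapsto 7$, $5\mapsto 8\,9$, $6\mapsto 10$, $7\mapsto 11\,12$, $8\mapsto 10\,13$, $9\mapsto 14$, $10\mapsto 10\,13$, $11\mapsto 5\,6$, $12\mapsto 15$, $13\mapsto 5$, $14\mapsto 8\,9$, $15\mapsto 11\,12$, and $g_2$ the coding $0,1,2,4,6,8,9,11,12,13,14,15\mapsto a$, $3,5,7,10\mapsto b$. Then $f_2$ is a $\varphi$-morphism, and the infinite word $g_2(f_2^\omega(0))=w_3w_4w_5\cdots$, whose letters are indexed starting from $3$, codes the non-terminal $\mathcal{P}$-positions of $K^2$: for every $n\ge 0$, $a_n$ is the index of the $(n+1)$-th occurrence of $a$ and $b_n$ is the index of the $(n+1)$-th occurrence of $b$ in this word.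
   Context: Positions are pairs $(x,y)\in\mathbb{N}^2$; a Wythoff move from $(x,y)$ leads to $(x-i,y)$ ($1\le i\le x$), $(x,y-i)$ ($1\le i\le y$) or $(x-i,y-i)$ ($1\le i\le\min(x,y)$). For $\ell\in\mathbb{N}$, $K^\ell$ is the impartial game with Wythoff moves in which the positions of $\{(x,y):x+y\le\ell\}$ are terminal: no move is allowed from them and a player who moves into one wins (normal play). A $\mathcal{P}$-position is one from which the previous player wins. The non-terminal $\mathcal{P}$-positions $(a,b)$ with $a<b$, listed in increasing order of $a$, are $(a_n,b_n)$, $n\ge0$. $f_2^\omega(0)$ denotes the fixed point of $f_2$ beginning with $0$. Fibonacci representation: $F_0=1,F_1=2,F_{n+2}=F_{n+1}+F_n$; $\mathrm{rep}_F(n)$ is the greedy representation of $n$ over $\{0,1\}$ without consecutive $1$'s ($\mathrm{rep}_F(0)$ empty, regarded as ending with $0$); for a word $u$, $[u]$ denotes the integer it represents. A morphism $\mu$ is a $\varphi$-morphism if its fixed point $\mathbf{w}=w_0w_1\cdots$ satisfies, for every $n$: if $\mathrm{rep}_F(n)$ ends with $1$ then $\mu(w_n)=w_{[\mathrm{rep}_F(n)0]}$, and if it ends with $0$ then $\mu(w_n)=w_{[\mathrm{rep}_F(n)0]}w_{[\mathrm{rep}_F(n)1]}$. -}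

module Defs where

open import Data.Nat using (ℕ; zero; suc; _+_; _*_; _∸_; _≤_; _<_; _≤?_)
open import Data.Fin using (Fin; #_)
open import Data.List using (List; []; _∷_; _++_; concatMap; reverse; last)
open import Data.Maybe using (Maybe; just; nothing)
open import Data.Product using (_×_; _,_; proj₁; proj₂; ∃; Σ)
open import Data.Sum using (_⊎_)
open import Relation.Nullary using (¬_; yes; no)
open import Relation.Binary.PropositionalEquality using (_≡_)

iterMorph : ∀ {k} → (Fin k → List (Fin k)) → ℕ → List (Fin k) → List (Fin k)
iterMorph μ zero    u = u
iterMorph μ (suc m) u = iterMorph μ m (concatMap μ u)

nth : ∀ {A : Set} → A → List A → ℕ → A
nth d []       _       = d
nth d (x ∷ xs) zero    = x
nth d (x ∷ xs) (suc i) = nth d xs i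

-- μ^ω(c): the infinite fixed point of a morphism prolongable on c
-- (μ(c) = c u with u nonempty); its n-th letter is the n-th letter of
-- μ^(n+1)(c), which has length > n in that case.
fixpt : ∀ {k} → (Fin k → List (Fin k)) → Fin k → ℕ → Fin k
fixpt μ c n = nth c (iterMorph μ (suc n) (c ∷ [])) n

fib : ℕ → ℕ
fib zero          = 1
fib (suc zero)    = 2
fib (suc (suc n)) = fib (suc n) + fib n

-- number of k ≤ m with F_k ≤ n  (applied with m = n this is the length
-- of rep_F(n): the least k with F_k > n)
countFibLe : ℕ → ℕ → ℕ
countFibLe n zero with fib zero ≤? n
... | yes _ = 1
... | no  _ = 0
countFibLe n (suc m) with fib (suc m) ≤? n
... | yes _ = suc (countFibLe n m)
... | no  _ = countFibLe n m

greedy : ℕ → ℕ → List ℕ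
greedy zero    m = []
greedy (suc k) m with fib k ≤? m
... | yes _ = 1 ∷ greedy k (m ∸ fib k)
... | no  _ = 0 ∷ greedy k m

-- rep_F(n), most significant digit first; rep_F(0) = []
repF : ℕ → List ℕ
repF n = greedy (countFibLe n n) n

valLSB : List ℕ → ℕ → ℕ
valLSB []       i = 0
valLSB (d ∷ ds) i = d * fib i + valLSB ds (suc i)

val : List ℕ → ℕ
val u = valLSB (reverse u) 0

-- rep_F(n) ends with 1 (the empty word is regarded as ending with 0)
EndsWith1 : List ℕ → Set
EndsWith1 u = last u ≡ just 1

IsPhiMorphism : ∀ {k} → (Fin k → List (Fin k)) → Fin k → Set
IsPhiMorphism μ c =
  ∀ n → (EndsWith1 (repF n) →
           μ (w n) ≡ w (val (repF n ++ 0 ∷ [])) ∷ [])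
      × (¬ EndsWith1 (repF n) →
           μ (w n) ≡ w (val (repF n ++ 0 ∷ [])) ∷ w (val (repF n ++ 1 ∷ [])) ∷ [])
  where
  w = fixpt μ c

f₂ : Fin 16 → List (Fin 16)
f₂ n with Data.Fin.toℕ n
... | 0  = (# 0) ∷ (# 1) ∷ []
... | 1  = (# 2) ∷ []
... | 2  = (# 3) ∷ (# 4) ∷ []
... | 3  = (# 5) ∷ (# 6) ∷ []
... | 4  = (# 7) ∷ []
... | 5  = (# 8) ∷ (# 9) ∷ []
... | 6  = (# 10) ∷ []
... | 7  = (# 11) ∷ (# 12) ∷ []
... | 8  = (# 10) ∷ (# 13) ∷ []
... | 9  = (# 14) ∷ []
... | 10 = (# 10) ∷ (# 13) ∷ []
... | 11 = (# 5) ∷ (# 6) ∷ []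
... | 12 = (# 15) ∷ []
... | 13 = (# 5) ∷ []
... | 14 = (# 8) ∷ (# 9) ∷ []
... | _  = (# 11) ∷ (# 12) ∷ []   -- letter 15

data AB : Set where
  a b : AB

_≟AB_ : (x y : AB) → Relation.Nullary.Dec (x ≡ y)
a ≟AB a = yes Relation.Binary.PropositionalEquality.refl
a ≟AB b = no λ ()
b ≟AB a = no λ ()
b ≟AB b = yes Relation.Binary.PropositionalEquality.refl

g₂ : Fin 16 → AB
g₂ n with Data.Fin.toℕ n
... | 3  = b
... | 5  = b
... | 7  = b
... | 10 = b
... | _  = a

-- letter number k of g₂(f₂^ω(0)); this letter carries the index k + 3
gw : ℕ → AB
gw k = g₂ (fixpt f₂ (# 0) k)

countBefore : AB → ℕ → ℕ
countBefore c zero = 0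
countBefore c (suc k) with gw k ≟AB c
... | yes _ = suc (countBefore c k)
... | no  _ = countBefore c k

NthOcc : AB → ℕ → ℕ → Set
NthOcc c n i = Σ ℕ λ k → i ≡ k + 3 × gw k ≡ c × countBefore c k ≡ n

Move : ℕ → ℕ → ℕ → ℕ → Set
Move x y x' y' =
    (x' < x × y' ≡ y)
  ⊎ (x' ≡ x × y' < y)
  ⊎ (Σ ℕ λ i → 1 ≤ i × x ≡ x' + i × y ≡ y' + i)

-- P- and N-positions of K^ℓ (terminal positions have no moves, so the
-- player to move from them loses: they are P-positions)
mutual
  data IsP (ℓ : ℕ) (x y : ℕ) : Set where
    terminal : x + y ≤ ℓ → IsP ℓ x y
    allToN   : ℓ < x + y → (∀ x' y' → Move x y x' y' → IsN ℓ x' y') → IsP ℓ x y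

  data IsN (ℓ : ℕ) (x y : ℕ) : Set where
    toP : ℓ < x + y → ∀ x' y' → Move x y x' y' → IsP ℓ x' y' → IsN ℓ x y

NonTermP : ℕ → ℕ → ℕ → Set
NonTermP ℓ x y = ℓ < x + y × IsP ℓ x y

IsPListing : ℕ → (ℕ → ℕ × ℕ) → Set
IsPListing ℓ s =
    (∀ n → proj₁ (s n) < proj₁ (s (suc n)))
  × (∀ n → proj₁ (s n) < proj₂ (s n) × NonTermP ℓ (proj₁ (s n)) (proj₂ (s n)))
  × (∀ x y → x < y → NonTermP ℓ x y → Σ ℕ λ n → s n ≡ (x , y))

-- Coding letters by the length of their image, f₂ becomes the Fibonacci morphism
-- 0 ↦ 01, 1 ↦ 0: every image starts with a letter whose image is long (length 2) and
-- continues, if at all, with one whose image is short (length 1).  Hence the lengths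
-- |f₂(w n)| follow the Fibonacci word, |f₂(w n)| = 2 − (last digit of rep_F(n)), and
-- f₂(w n) starts at position [rep_F(n)0] of w, which is the φ-morphism property.
--
-- For the game, all factors of length 3 of w lie in an explicit list that is closed
-- under f₂, so local rules can be checked on that list: the image of w (j + 2) starts
-- with b exactly when w j is a, bb never occurs, and the number of long images among
-- w 0 … w (j + 1) exceeds the number of a's among w 0 … w j by a potential of the
-- factor w j w (j + 1), which vanishes when w j is a.  As b occurs in images only in
-- first position, counting puts the (n+1)-th b at A n + n + 3, where A n is the
-- position of the (n+1)-th a, and the two position sequences partition ℕ.  Finally,
-- complementary sequences with B n − A n = n + ℓ + 1 are exactly the non-terminal
-- P-positions of K^ℓ: no move joins two such pairs, and from any other non-terminal
-- position one can move to a pair or to a terminal position.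

module Submission where

open import Defs
open import Data.Empty using (⊥; ⊥-elim)
open import Data.Fin using (Fin; #_; toℕ; fromℕ<)
open import Data.Fin.Properties using (toℕ-fromℕ<)
import Data.Fin.Properties as Fin
open import Data.List using (List; []; _∷_; _++_; concatMap; length; map; reverse; last; replicate)
open import Data.List.Properties
  using (length-++; concatMap-++; ++-identityʳ; length-map; reverse-++; unfold-reverse; length-reverse; ∷-injective)
import Data.List.Properties as List
import Data.List.Relation.Unary.All as All
open import Data.List.Relation.Unary.Any using (here)
open import Data.Maybe using (Maybe; just; nothing; fromMaybe)
open import Data.Nat using (ℕ; zero; suc; _+_; _*_; _∸_; _≤_; _<_; z≤n; s≤s; _≤?_; _<?_)
open import Data.Nat.Induction using (<-rec)
open import Data.Nat.ListAction using (sum)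
open import Data.Nat.Properties
open import Data.Nat.Tactic.RingSolver using (solve-∀)
open import Data.Product using (_×_; _,_; proj₁; proj₂; Σ; ∃-syntax)
import Data.Product.Properties as Product
open import Data.Sum using (_⊎_; inj₁; inj₂)
open import Function using (_∘_)
open import Relation.Binary using (tri<; tri≈; tri>; DecidableEquality)
open import Relation.Binary.PropositionalEquality
open import Relation.Nullary using (¬_; Dec; yes; no)
open import Relation.Nullary.Decidable using (True; from-yes; toWitness; _→-dec_)

nth-++ˡ : ∀ {A : Set} (d : A) u {v i} → i < length u → nth d (u ++ v) i ≡ nth d u i
nth-++ˡ d (x ∷ u) {i = zero}  _         = refl
nth-++ˡ d (x ∷ u) {i = suc i} (s≤s i<u) = nth-++ˡ d u i<u

nth-++ʳ : ∀ {A : Set} (d : A) u {v} i → nth d (u ++ v) (length u + i) ≡ nth d v i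
nth-++ʳ d []      i = refl
nth-++ʳ d (x ∷ u) i = nth-++ʳ d u i

length≡1 : ∀ {A : Set} (d : A) u → length u ≡ 1 → u ≡ nth d u 0 ∷ []
length≡1 d (x ∷ []) refl = refl

length≡2 : ∀ {A : Set} (d : A) u → length u ≡ 2 → u ≡ nth d u 0 ∷ nth d u 1 ∷ []
length≡2 d (x ∷ y ∷ []) refl = refl

count : (ℕ → ℕ) → ℕ → ℕ
count p zero    = 0
count p (suc k) = count p k + p k

count-cong : ∀ {p q} k → (∀ {j} → j < k → p j ≡ q j) → count p k ≡ count q k
count-cong zero    _   = refl
count-cong (suc k) p≡q = cong₂ _+_ (count-cong k (p≡q ∘ m<n⇒m<1+n)) (p≡q (n<1+n k))

count-+ : ∀ p n l → count p (n + l) ≡ count p n + count (λ i → p (n + i)) l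
count-+ p n zero    = trans (cong (count p) (+-identityʳ n)) (sym (+-identityʳ _))
count-+ p n (suc l) = begin
  count p (n + suc l)                                ≡⟨ cong (count p) (+-suc n l) ⟩
  count p (n + l) + p (n + l)                        ≡⟨ cong (_+ p (n + l)) (count-+ p n l) ⟩
  count p n + count (λ i → p (n + i)) l + p (n + l)  ≡⟨ +-assoc (count p n) _ _ ⟩
  count p n + count (λ i → p (n + i)) (suc l)        ∎
  where open ≡-Reasoning

count-suc : ∀ p n → count p (suc n) ≡ p 0 + count (p ∘ suc) n
count-suc p zero    = +-comm 0 (p 0)
count-suc p (suc n) = trans (cong (_+ p (suc n)) (count-suc p n)) (+-assoc (p 0) _ _)

count-nth : ∀ {A : Set} (d : A) (p : A → ℕ) u → count (λ i → p (nth d u i)) (length u) ≡ sum (map p u)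
count-nth d p []      = refl
count-nth d p (x ∷ u) = trans (count-suc (λ i → p (nth d (x ∷ u) i)) (length u)) (cong (p x +_) (count-nth d p u))

count-< : ∀ p {k k′} → p k ≡ 1 → k < k′ → count p k < count p k′
count-< p {k} {suc k′} pk≡1 k<1+k′ with m≤n⇒m<n∨m≡n (≤-pred k<1+k′)
... | inj₁ k<k′ = ≤-trans (count-< p pk≡1 k<k′) (m≤m+n _ (p k′))
... | inj₂ refl = subst (λ v → count p k < count p k + v) (sym pk≡1) (≤-reflexive (+-comm 1 (count p k)))

count-injective : ∀ p {k k′} → p k ≡ 1 → p k′ ≡ 1 → count p k ≡ count p k′ → k ≡ k′
count-injective p {k} {k′} pk≡1 pk′≡1 counts≡ with <-cmp k k′
... | tri< k<k′ _ _ = ⊥-elim (<⇒≢ (count-< p pk≡1 k<k′) counts≡)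
... | tri≈ _ k≡k′ _ = k≡k′
... | tri> _ _ k′<k = ⊥-elim (<⇒≢ (count-< p pk′≡1 k′<k) (sym counts≡))

module Prolongable {k} (μ : Fin k → List (Fin k)) {c d : Fin k} {ds : List (Fin k)}
                   (prolongable : μ c ≡ c ∷ d ∷ ds) (nonErasing : ∀ x → 1 ≤ length (μ x)) where

  w : ℕ → Fin k
  w = fixpt μ c

  iterMorph-++ : ∀ t u v → iterMorph μ t (u ++ v) ≡ iterMorph μ t u ++ iterMorph μ t v
  iterMorph-++ zero    u v = refl
  iterMorph-++ (suc t) u v =
    trans (cong (iterMorph μ t) (concatMap-++ μ u v)) (iterMorph-++ t (concatMap μ u) (concatMap μ v))

  iterMorph-suc : ∀ t u → iterMorph μ (suc t) u ≡ concatMap μ (iterMorph μ t u)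
  iterMorph-suc zero    u = refl
  iterMorph-suc (suc t) u = iterMorph-suc t (concatMap μ u)

  length-concatMap : ∀ u → length u ≤ length (concatMap μ u)
  length-concatMap []      = z≤n
  length-concatMap (x ∷ u) =
    subst (suc (length u) ≤_) (sym (length-++ (μ x))) (+-mono-≤ (nonErasing x) (length-concatMap u))

  length-iterMorph : ∀ t u → length u ≤ length (iterMorph μ t u)
  length-iterMorph zero    u = ≤-refl
  length-iterMorph (suc t) u = ≤-trans (length-concatMap u) (length-iterMorph t (concatMap μ u))

  μ^ : ℕ → List (Fin k)
  μ^ t = iterMorph μ t (c ∷ [])

  μ^-suc : ∀ t → μ^ (suc t) ≡ μ^ t ++ iterMorph μ t (d ∷ ds)
  μ^-suc t = trans (cong (iterMorph μ t) (trans (++-identityʳ (μ c)) prolongable))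
                   (iterMorph-++ t (c ∷ []) (d ∷ ds))

  length-μ^-suc : ∀ t → length (μ^ t) < length (μ^ (suc t))
  length-μ^-suc t = subst (length (μ^ t) <_) (sym (trans (cong length (μ^-suc t)) (length-++ (μ^ t))))
                          (m<m+n (length (μ^ t)) (≤-trans (s≤s z≤n) (length-iterMorph t (d ∷ ds))))

  length-μ^-mono : ∀ j t → length (μ^ t) ≤ length (μ^ (j + t))
  length-μ^-mono zero    t = ≤-refl
  length-μ^-mono (suc j) t = ≤-trans (length-μ^-mono j t) (<⇒≤ (length-μ^-suc (j + t)))

  t<length-μ^ : ∀ t → t < length (μ^ t)
  t<length-μ^ zero    = s≤s z≤n
  t<length-μ^ (suc t) = <-≤-trans (s≤s (t<length-μ^ t)) (length-μ^-suc t)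

  nth-μ^-stable : ∀ j t {n} → n < length (μ^ t) → nth c (μ^ (j + t)) n ≡ nth c (μ^ t) n
  nth-μ^-stable zero    t     n< = refl
  nth-μ^-stable (suc j) t {n} n< = begin
    nth c (μ^ (suc (j + t))) n    ≡⟨ cong (λ u → nth c u n) (μ^-suc (j + t)) ⟩
    nth c (μ^ (j + t) ++ _) n     ≡⟨ nth-++ˡ c (μ^ (j + t)) (<-≤-trans n< (length-μ^-mono j t)) ⟩
    nth c (μ^ (j + t)) n          ≡⟨ nth-μ^-stable j t n< ⟩
    nth c (μ^ t) n                ∎
    where open ≡-Reasoning

  nth-μ^ : ∀ t {n} → n < length (μ^ t) → nth c (μ^ t) n ≡ w n
  nth-μ^ t {n} n< = begin
    nth c (μ^ t) n              ≡⟨ sym (nth-μ^-stable (suc n) t n<) ⟩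
    nth c (μ^ (suc n + t)) n    ≡⟨ cong (λ s → nth c (μ^ s) n) (+-comm (suc n) t) ⟩
    nth c (μ^ (t + suc n)) n    ≡⟨ nth-μ^-stable t (suc n) (<-trans (n<1+n n) (t<length-μ^ (suc n))) ⟩
    w n                         ∎
    where open ≡-Reasoning

  start : ℕ → ℕ
  start zero    = 0
  start (suc m) = start m + length (μ (w m))

  startIn : List (Fin k) → ℕ → ℕ
  startIn u zero    = 0
  startIn u (suc m) = startIn u m + length (μ (nth c u m))

  startIn-∷ : ∀ x u m → startIn (x ∷ u) (suc m) ≡ length (μ x) + startIn u m
  startIn-∷ x u zero    = sym (+-identityʳ (length (μ x)))
  startIn-∷ x u (suc m) =
    trans (cong (_+ length (μ (nth c u m))) (startIn-∷ x u m)) (+-assoc (length (μ x)) _ _)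

  nth-concatMap : ∀ u {m i} → m < length u → i < length (μ (nth c u m))
                  → nth c (concatMap μ u) (startIn u m + i) ≡ nth c (μ (nth c u m)) i
  nth-concatMap (x ∷ u) {zero}      _         i< = nth-++ˡ c (μ x) i<
  nth-concatMap (x ∷ u) {suc m} {i} (s≤s m<u) i< = begin
    nth c (μ x ++ concatMap μ u) (startIn (x ∷ u) (suc m) + i)
      ≡⟨ cong (nth c (μ x ++ concatMap μ u)) shift ⟩
    nth c (μ x ++ concatMap μ u) (length (μ x) + (startIn u m + i))
      ≡⟨ nth-++ʳ c (μ x) _ ⟩
    nth c (concatMap μ u) (startIn u m + i)
      ≡⟨ nth-concatMap u m<u i< ⟩
    nth c (μ (nth c u m)) i
      ∎
    where
    open ≡-Reasoning
    shift : startIn (x ∷ u) (suc m) + i ≡ length (μ x) + (startIn u m + i)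
    shift = trans (cong (_+ i) (startIn-∷ x u m)) (+-assoc (length (μ x)) _ i)

  startIn-μ^ : ∀ t m → m ≤ length (μ^ t) → startIn (μ^ t) m ≡ start m
  startIn-μ^ t zero    _  = refl
  startIn-μ^ t (suc m) m< = cong₂ _+_ (startIn-μ^ t m (<⇒≤ m<)) (cong (length ∘ μ) (nth-μ^ t m<))

  start-suc : ∀ m → suc m < start (suc m)
  start-suc zero    = subst (λ u → 1 < length u) (sym (trans (cong μ w0≡c) prolongable)) (s≤s (s≤s z≤n))
    where
    w0≡c : w 0 ≡ c
    w0≡c = cong (λ u → nth c (u ++ []) 0) prolongable
  start-suc (suc m) = subst (_≤ start (2 + m)) (+-comm (2 + m) 1) (+-mono-≤ (start-suc m) (nonErasing (w (suc m))))

  m≤start : ∀ m → m ≤ start m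
  m≤start zero    = z≤n
  m≤start (suc m) = <⇒≤ (start-suc m)

  selfSimilar : ∀ m {i} → i < length (μ (w m)) → w (start m + i) ≡ nth c (μ (w m)) i
  selfSimilar m {i} i< = begin
    nth c (μ^ (suc N)) (start m + i)
      ≡⟨ cong₂ (nth c) (iterMorph-suc N (c ∷ [])) (cong (_+ i) (sym (startIn-μ^ N m (<⇒≤ m<)))) ⟩
    nth c (concatMap μ (μ^ N)) (startIn (μ^ N) m + i)
      ≡⟨ nth-concatMap (μ^ N) m< (subst (λ x → i < length (μ x)) (sym wm) i<) ⟩
    nth c (μ (nth c (μ^ N) m)) i
      ≡⟨ cong (λ x → nth c (μ x) i) wm ⟩
    nth c (μ (w m)) i
      ∎
    where
    open ≡-Reasoning
    N = start m + i
    m< : m < length (μ^ N)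
    m< = ≤-<-trans (≤-trans (m≤start m) (m≤m+n (start m) i)) (t<length-μ^ N)
    wm : nth c (μ^ N) m ≡ w m
    wm = nth-μ^ N m<

  decompose : ∀ j → ∃[ m ] ∃[ r ] j ≡ start m + r × r < length (μ (w m))
  decompose zero = 0 , 0 , refl , nonErasing (w 0)
  decompose (suc j) with decompose j
  ... | m , r , j≡ , r< with suc r <? length (μ (w m))
  ...   | yes r+1< = m , suc r , trans (cong suc j≡) (sym (+-suc (start m) r)) , r+1<
  ...   | no  r+1≮ = suc m , 0 , j+1≡ , nonErasing (w (suc m))
    where
    j+1≡ : suc j ≡ start (suc m) + 0
    j+1≡ = begin
      suc j                ≡⟨ cong suc j≡ ⟩
      suc (start m + r)    ≡⟨ sym (+-suc (start m) r) ⟩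
      start m + suc r      ≡⟨ cong (start m +_) (≤-antisym r< (≮⇒≥ r+1≮)) ⟩
      start (suc m)        ≡⟨ sym (+-identityʳ _) ⟩
      start (suc m) + 0    ∎
      where open ≡-Reasoning

  images : ℕ → ℕ → List (Fin k)
  images m zero    = []
  images m (suc q) = μ (w m) ++ images (suc m) q

  selfSimilar-images : ∀ q m {i} → i < length (images m q) → w (start m + i) ≡ nth c (images m q) i
  selfSimilar-images (suc q) m {i} i< with i <? length (μ (w m))
  ... | yes i<μ = trans (selfSimilar m i<μ) (sym (nth-++ˡ c (μ (w m)) i<μ))
  ... | no  i≮μ = begin
    w (start m + i)                      ≡⟨ cong (λ j → w (start m + j)) (sym i≡) ⟩
    w (start m + (L + i′))               ≡⟨ cong w (sym (+-assoc (start m) L i′)) ⟩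
    w (start (suc m) + i′)               ≡⟨ selfSimilar-images q (suc m) i′< ⟩
    nth c (images (suc m) q) i′          ≡⟨ sym (nth-++ʳ c (μ (w m)) i′) ⟩
    nth c (images m (suc q)) (L + i′)    ≡⟨ cong (nth c (images m (suc q))) i≡ ⟩
    nth c (images m (suc q)) i           ∎
    where
    open ≡-Reasoning
    L  = length (μ (w m))
    i′ = i ∸ L
    i≡ : L + i′ ≡ i
    i≡ = m+[n∸m]≡n (≮⇒≥ i≮μ)
    i′< : i′ < length (images (suc m) q)
    i′< = +-cancelˡ-< L _ _ (subst₂ _<_ (sym i≡) (length-++ (μ (w m))) i<)

  Factor₃ : Set
  Factor₃ = Fin k × Fin k × Fin k

  factor₃ : ℕ → Factor₃
  factor₃ j = w j , w (suc j) , w (suc (suc j))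

  window₃ : List (Fin k) → ℕ → Factor₃
  window₃ u r = nth c u r , nth c u (suc r) , nth c u (suc (suc r))

  factor₃-images : ∀ m {r} → r < length (μ (w m)) → factor₃ (start m + r) ≡ window₃ (images m 3) r
  factor₃-images m {r} r< = cong₂ _,_ (at 0 z≤n) (cong₂ _,_ (at 1 (s≤s z≤n)) (at 2 ≤-refl))
    where
    lengths : length (images m 3) ≡ length (μ (w m)) + (length (μ (w (1 + m))) + (length (μ (w (2 + m))) + 0))
    lengths = trans (length-++ (μ (w m))) (cong (length (μ (w m)) +_)
      (trans (length-++ (μ (w (1 + m)))) (cong (length (μ (w (1 + m))) +_) (length-++ (μ (w (2 + m)))))))
    r+2< : 2 + r < length (images m 3)
    r+2< = subst₂ _≤_ (+-comm (suc r) 2) (sym lengths)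
                 (+-mono-≤ r< (+-mono-≤ (nonErasing _) (+-mono-≤ (nonErasing _) z≤n)))
    rearrange : ∀ o → o + (start m + r) ≡ start m + (o + r)
    rearrange o = trans (sym (+-assoc o (start m) r)) (trans (cong (_+ r) (+-comm o (start m))) (+-assoc (start m) o r))
    at : ∀ o → o ≤ 2 → w (o + (start m + r)) ≡ nth c (images m 3) (o + r)
    at o o≤2 = trans (cong w (rearrange o)) (selfSimilar-images 3 m (≤-<-trans (+-monoˡ-≤ r o≤2) r+2<))

  factor₃-closure : (Q : Factor₃ → Set) → Q (factor₃ 0)
    → (∀ {x y z} → Q (x , y , z) → ∀ {r} → r < length (μ x) → Q (window₃ (concatMap μ (x ∷ y ∷ z ∷ [])) r))
    → ∀ j → Q (factor₃ j)
  factor₃-closure Q base closed = <-rec _ step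
    where
    fromImage : ∀ m {r} → m < start m + r → r < length (μ (w m))
                → (∀ {i} → i < start m + r → Q (factor₃ i)) → Q (factor₃ (start m + r))
    fromImage m m< r< ih = subst Q (sym (factor₃-images m r<)) (closed (ih m<) r<)
    step : ∀ j → (∀ {i} → i < j → Q (factor₃ i)) → Q (factor₃ j)
    step j ih with decompose j
    ... | zero  , zero  , refl , _  = base
    ... | zero  , suc r , refl , r< = fromImage zero (s≤s z≤n) r< ih
    ... | suc m , r     , refl , r< = fromImage (suc m) (<-≤-trans (start-suc m) (m≤m+n _ r)) r< ih

  start≡+count : ∀ m → start m ≡ m + count (λ j → length (μ (w j)) ∸ 1) m
  start≡+count zero    = refl
  start≡+count (suc m) = begin
    start m + length (μ (w m))              ≡⟨ cong₂ _+_ (start≡+count m) (sym (m+[n∸m]≡n (nonErasing (w m)))) ⟩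
    m + C + (1 + (length (μ (w m)) ∸ 1))    ≡⟨ rearrange m C _ ⟩
    suc m + (C + (length (μ (w m)) ∸ 1))    ∎
    where
    open ≡-Reasoning
    C = count (λ j → length (μ (w j)) ∸ 1) m
    rearrange : ∀ m c e → m + c + (1 + e) ≡ suc m + (c + e)
    rearrange = solve-∀

  count-images : ∀ (p : Fin k → ℕ) m → count (p ∘ w) (start m) ≡ count (λ j → sum (map p (μ (w j)))) m
  count-images p zero    = refl
  count-images p (suc m) = begin
    count (p ∘ w) (start m + length (μ (w m)))
      ≡⟨ count-+ (p ∘ w) (start m) _ ⟩
    count (p ∘ w) (start m) + count (λ i → p (w (start m + i))) (length (μ (w m)))
      ≡⟨ cong₂ _+_ (count-images p m) image ⟩
    count (λ j → sum (map p (μ (w j)))) m + sum (map p (μ (w m)))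
      ∎
    where
    open ≡-Reasoning
    image : count (λ i → p (w (start m + i))) (length (μ (w m))) ≡ sum (map p (μ (w m)))
    image = trans (count-cong _ (cong p ∘ selfSimilar m)) (count-nth c p (μ (w m)))

k<fib : ∀ k → k < fib k
k<fib zero          = s≤s z≤n
k<fib (suc zero)    = s≤s (s≤s z≤n)
k<fib (suc (suc k)) = subst (_≤ fib (2 + k)) (+-comm (2 + k) 1) (+-mono-≤ (k<fib (suc k)) (≤-<-trans z≤n (k<fib k)))

0<fib : ∀ k → 0 < fib k
0<fib k = ≤-<-trans z≤n (k<fib k)

fib-< : ∀ k → fib k < fib (suc k)
fib-< zero    = s≤s (s≤s z≤n)
fib-< (suc k) = m<m+n (fib (suc k)) (0<fib k)

fib-mono : ∀ {k k′} → k ≤ k′ → fib k ≤ fib k′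
fib-mono {k′ = zero}   z≤n = ≤-refl
fib-mono {k′ = suc k′} k≤ with m≤n⇒m<n∨m≡n k≤
... | inj₁ k<   = ≤-trans (fib-mono (≤-pred k<)) (<⇒≤ (fib-< k′))
... | inj₂ refl = ≤-refl

greedy-< : ∀ k {m} → m < fib k → greedy (suc k) m ≡ 0 ∷ greedy k m
greedy-< k {m} m< with fib k ≤? m
... | yes fib≤ = ⊥-elim (<⇒≱ m< fib≤)
... | no  _    = refl

greedy-≥ : ∀ k {m} → fib k ≤ m → greedy (suc k) m ≡ 1 ∷ greedy k (m ∸ fib k)
greedy-≥ k {m} fib≤ with fib k ≤? m
... | yes _    = refl
... | no  fib≰ = ⊥-elim (fib≰ fib≤)

length-greedy : ∀ k m → length (greedy k m) ≡ k
length-greedy zero    m = refl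
length-greedy (suc k) m with fib k ≤? m
... | yes _ = cong suc (length-greedy k (m ∸ fib k))
... | no  _ = cong suc (length-greedy k m)

shiftedVal : List ℕ → ℕ
shiftedVal u = valLSB (reverse u) 1

lastDigit : List ℕ → ℕ
lastDigit u = fromMaybe 0 (last u)

valLSB-∷ʳ : ∀ xs d i → valLSB (xs ++ d ∷ []) i ≡ valLSB xs i + d * fib (i + length xs)
valLSB-∷ʳ []       d i = trans (+-identityʳ _) (cong (λ j → d * fib j) (sym (+-identityʳ i)))
valLSB-∷ʳ (x ∷ xs) d i = begin
  x * fib i + valLSB (xs ++ d ∷ []) (suc i)
    ≡⟨ cong (x * fib i +_) (valLSB-∷ʳ xs d (suc i)) ⟩
  x * fib i + (valLSB xs (suc i) + d * fib (suc i + length xs))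
    ≡⟨ sym (+-assoc (x * fib i) _ _) ⟩
  x * fib i + valLSB xs (suc i) + d * fib (suc (i + length xs))
    ≡⟨ cong (λ j → x * fib i + valLSB xs (suc i) + d * fib j) (sym (+-suc i (length xs))) ⟩
  x * fib i + valLSB xs (suc i) + d * fib (i + suc (length xs))
    ∎
  where open ≡-Reasoning

valLSB-reverse-∷ : ∀ d u i → valLSB (reverse (d ∷ u)) i ≡ d * fib (i + length u) + valLSB (reverse u) i
valLSB-reverse-∷ d u i = begin
  valLSB (reverse (d ∷ u)) i
    ≡⟨ cong (λ v → valLSB v i) (unfold-reverse d u) ⟩
  valLSB (reverse u ++ d ∷ []) i
    ≡⟨ valLSB-∷ʳ (reverse u) d i ⟩
  valLSB (reverse u) i + d * fib (i + length (reverse u))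
    ≡⟨ +-comm (valLSB (reverse u) i) _ ⟩
  d * fib (i + length (reverse u)) + valLSB (reverse u) i
    ≡⟨ cong (λ j → d * fib (i + j) + valLSB (reverse u) i) (length-reverse u) ⟩
  d * fib (i + length u) + valLSB (reverse u) i
    ∎
  where open ≡-Reasoning

val-∷ : ∀ d u → val (d ∷ u) ≡ d * fib (length u) + val u
val-∷ d u = valLSB-reverse-∷ d u 0

val-10∷ : ∀ u → val (1 ∷ 0 ∷ u) ≡ fib (suc (length u)) + val u
val-10∷ u = trans (val-∷ 1 (0 ∷ u)) (cong₂ _+_ (*-identityˡ _) (val-∷ 0 u))

val-∷ʳ : ∀ u d → val (u ++ d ∷ []) ≡ d * 1 + shiftedVal u
val-∷ʳ u d = cong (λ v → valLSB v 0) (reverse-++ u (d ∷ []))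

shiftedVal-∷ : ∀ d u → shiftedVal (d ∷ u) ≡ d * fib (suc (length u)) + shiftedVal u
shiftedVal-∷ d u = valLSB-reverse-∷ d u 1

lastDigit-0∷ : ∀ u → lastDigit (0 ∷ u) ≡ lastDigit u
lastDigit-0∷ []      = refl
lastDigit-0∷ (_ ∷ _) = refl

lastDigit-∷ʳ : ∀ u d → lastDigit (u ++ d ∷ []) ≡ d
lastDigit-∷ʳ []          d = refl
lastDigit-∷ʳ (_ ∷ [])    d = refl
lastDigit-∷ʳ (_ ∷ x ∷ u) d = lastDigit-∷ʳ (x ∷ u) d

lastDigit-1∷greedy : ∀ k m → lastDigit (1 ∷ greedy (suc k) m) ≡ lastDigit (greedy (suc k) m)
lastDigit-1∷greedy k m with fib k ≤? m
... | yes _ = refl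
... | no  _ = refl

data Zeckendorf : List ℕ → Set where
  []    : Zeckendorf []
  0∷_   : ∀ {u} → Zeckendorf u → Zeckendorf (0 ∷ u)
  1∷[]  : Zeckendorf (1 ∷ [])
  1∷0∷_ : ∀ {u} → Zeckendorf u → Zeckendorf (1 ∷ 0 ∷ u)

val<fib : ∀ {u} → Zeckendorf u → val u < fib (length u)
val<fib []            = s≤s z≤n
val<fib (0∷_ {u} z)   = subst (_< fib (suc (length u))) (sym (val-∷ 0 u)) (<-trans (val<fib z) (fib-< (length u)))
val<fib 1∷[]          = s≤s (s≤s z≤n)
val<fib (1∷0∷_ {u} z) = subst (_< fib (2 + length u)) (sym (val-10∷ u)) (+-monoʳ-< (fib (suc (length u))) (val<fib z))

greedy-val : ∀ {u} → Zeckendorf u → greedy (length u) (val u) ≡ u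
greedy-val []            = refl
greedy-val (0∷_ {u} z)   = begin
  greedy (suc (length u)) (val (0 ∷ u))    ≡⟨ cong (greedy _) (val-∷ 0 u) ⟩
  greedy (suc (length u)) (val u)          ≡⟨ greedy-< (length u) (val<fib z) ⟩
  0 ∷ greedy (length u) (val u)            ≡⟨ cong (0 ∷_) (greedy-val z) ⟩
  0 ∷ u                                    ∎
  where open ≡-Reasoning
greedy-val 1∷[]          = refl
greedy-val (1∷0∷_ {u} z) = begin
  greedy (2 + length u) (val (1 ∷ 0 ∷ u))    ≡⟨ cong (greedy _) (val-10∷ u) ⟩
  greedy (2 + length u) (F + val u)          ≡⟨ greedy-≥ (suc (length u)) (m≤m+n F (val u)) ⟩
  1 ∷ tail (F + val u ∸ F)                   ≡⟨ cong ((1 ∷_) ∘ tail) (m+n∸m≡n F (val u)) ⟩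
  1 ∷ tail (val u)                           ≡⟨ cong ((1 ∷_) ∘ tail) (sym (val-∷ 0 u)) ⟩
  1 ∷ tail (val (0 ∷ u))                     ≡⟨ cong (1 ∷_) (greedy-val (0∷ z)) ⟩
  1 ∷ 0 ∷ u                                  ∎
  where
  open ≡-Reasoning
  F = fib (suc (length u))
  tail = greedy (suc (length u))

greedy-Zeckendorf : ∀ k {m} → m < fib k → Zeckendorf (greedy k m)
greedy-Zeckendorf zero              _  = []
greedy-Zeckendorf (suc k)       {m} m< with fib k ≤? m
greedy-Zeckendorf (suc k)           m< | no  fib≰ = 0∷ greedy-Zeckendorf k (≰⇒> fib≰)
greedy-Zeckendorf (suc zero)        m< | yes _    = 1∷[]
greedy-Zeckendorf (suc (suc k)) {m} m< | yes fib≤ =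
  subst (λ v → Zeckendorf (1 ∷ v)) (sym (greedy-< k m′<)) (1∷0∷ greedy-Zeckendorf k m′<)
  where
  m′< : m ∸ fib (suc k) < fib k
  m′< = subst (m ∸ fib (suc k) <_) (m+n∸m≡n (fib (suc k)) (fib k)) (∸-monoˡ-< m< fib≤)

Zeckendorf-∷ʳ0 : ∀ {u} → Zeckendorf u → Zeckendorf (u ++ 0 ∷ [])
Zeckendorf-∷ʳ0 []       = 0∷ []
Zeckendorf-∷ʳ0 (0∷ z)   = 0∷ Zeckendorf-∷ʳ0 z
Zeckendorf-∷ʳ0 1∷[]     = 1∷0∷ []
Zeckendorf-∷ʳ0 (1∷0∷ z) = 1∷0∷ Zeckendorf-∷ʳ0 z

Zeckendorf-∷ʳ1 : ∀ {u} → Zeckendorf u → lastDigit u ≡ 0 → Zeckendorf (u ++ 1 ∷ [])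
Zeckendorf-∷ʳ1 []            _  = 1∷[]
Zeckendorf-∷ʳ1 (0∷_ {u} z)   u0 = 0∷ Zeckendorf-∷ʳ1 z (trans (sym (lastDigit-0∷ u)) u0)
Zeckendorf-∷ʳ1 1∷[]          ()
Zeckendorf-∷ʳ1 (1∷0∷_ {u} z) u0 = 1∷0∷ Zeckendorf-∷ʳ1 z (trans (sym (lastDigit-0∷ u)) u0)

lastDigit≤1 : ∀ {u} → Zeckendorf u → lastDigit u ≤ 1
lastDigit≤1 []            = z≤n
lastDigit≤1 (0∷_ {u} z)   = subst (_≤ 1) (sym (lastDigit-0∷ u)) (lastDigit≤1 z)
lastDigit≤1 1∷[]          = ≤-refl
lastDigit≤1 (1∷0∷_ {u} z) = subst (_≤ 1) (sym (lastDigit-0∷ u)) (lastDigit≤1 z)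

-- shift and digit₀ (below) read off the k-digit representation greedy k m, which is
-- rep_F(m) padded with leading zeros when m < fib k.
shiftᵏ : ℕ → ℕ → ℕ
shiftᵏ k m = shiftedVal (greedy k m)

digit₀ᵏ : ℕ → ℕ → ℕ
digit₀ᵏ k m = lastDigit (greedy k m)

shiftᵏ-< : ∀ k {m} → m < fib k → shiftᵏ (suc k) m ≡ shiftᵏ k m
shiftᵏ-< k {m} m< = trans (cong shiftedVal (greedy-< k m<)) (shiftedVal-∷ 0 (greedy k m))

shiftᵏ-≥ : ∀ k {m} → fib k ≤ m → shiftᵏ (suc k) m ≡ fib (suc k) + shiftᵏ k (m ∸ fib k)
shiftᵏ-≥ k {m} fib≤ = begin
  shiftᵏ (suc k) m
    ≡⟨ cong shiftedVal (greedy-≥ k fib≤) ⟩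
  shiftedVal (1 ∷ greedy k m′)
    ≡⟨ shiftedVal-∷ 1 (greedy k m′) ⟩
  1 * fib (suc (length (greedy k m′))) + shiftᵏ k m′
    ≡⟨ cong (_+ shiftᵏ k m′) (*-identityˡ _) ⟩
  fib (suc (length (greedy k m′))) + shiftᵏ k m′
    ≡⟨ cong (λ l → fib (suc l) + shiftᵏ k m′) (length-greedy k m′) ⟩
  fib (suc k) + shiftᵏ k m′
    ∎
  where
  open ≡-Reasoning
  m′ = m ∸ fib k

shiftᵏ-0 : ∀ k → shiftᵏ k 0 ≡ 0
shiftᵏ-0 zero    = refl
shiftᵏ-0 (suc k) = trans (shiftᵏ-< k (0<fib k)) (shiftᵏ-0 k)

digit₀ᵏ-< : ∀ k {m} → m < fib k → digit₀ᵏ (suc k) m ≡ digit₀ᵏ k m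
digit₀ᵏ-< k {m} m< = trans (cong lastDigit (greedy-< k m<)) (lastDigit-0∷ (greedy k m))

digit₀ᵏ-≥ : ∀ k {m} → fib (suc k) ≤ m → digit₀ᵏ (2 + k) m ≡ digit₀ᵏ (suc k) (m ∸ fib (suc k))
digit₀ᵏ-≥ k {m} fib≤ = trans (cong lastDigit (greedy-≥ (suc k) fib≤)) (lastDigit-1∷greedy k (m ∸ fib (suc k)))

shiftᵏ-max : ∀ k {m} → suc m ≡ fib k → shiftᵏ k m + 2 ≡ fib (suc k) + digit₀ᵏ k m
shiftᵏ-max zero          {zero}     refl = refl
shiftᵏ-max (suc zero)    {suc zero} refl = refl
shiftᵏ-max (suc (suc k)) {m}        m+1≡ = begin
  shiftᵏ (2 + k) m + 2
    ≡⟨ cong (_+ 2) (trans (shiftᵏ-≥ (suc k) fib≤) (cong (fib (2 + k) +_) (shiftᵏ-< k m′<))) ⟩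
  fib (2 + k) + shiftᵏ k m′ + 2
    ≡⟨ +-assoc (fib (2 + k)) _ 2 ⟩
  fib (2 + k) + (shiftᵏ k m′ + 2)
    ≡⟨ cong (fib (2 + k) +_) (shiftᵏ-max k m′+1≡) ⟩
  fib (2 + k) + (fib (suc k) + digit₀ᵏ k m′)
    ≡⟨ sym (+-assoc (fib (2 + k)) _ _) ⟩
  fib (3 + k) + digit₀ᵏ k m′
    ≡⟨ cong (fib (3 + k) +_) (sym (trans (digit₀ᵏ-≥ k fib≤) (digit₀ᵏ-< k m′<))) ⟩
  fib (3 + k) + digit₀ᵏ (2 + k) m
    ∎
  where
  open ≡-Reasoning
  fib≤ : fib (suc k) ≤ m
  fib≤ = ≤-pred (subst (fib (suc k) <_) (sym m+1≡) (fib-< (suc k)))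
  m′ = m ∸ fib (suc k)
  m′+1≡ : suc m′ ≡ fib k
  m′+1≡ = +-cancelˡ-≡ (fib (suc k)) _ _
            (trans (+-suc (fib (suc k)) m′) (trans (cong suc (m+[n∸m]≡n fib≤)) m+1≡))
  m′< : m′ < fib k
  m′< = ≤-reflexive m′+1≡

shiftᵏ-fib : ∀ k {m} → suc m ≡ fib k → shiftᵏ (suc k) (suc m) ≡ fib (suc k)
shiftᵏ-fib k {m} m+1≡ = begin
  shiftᵏ (suc k) (suc m)                    ≡⟨ shiftᵏ-≥ k (≤-reflexive (sym m+1≡)) ⟩
  fib (suc k) + shiftᵏ k (suc m ∸ fib k)    ≡⟨ cong (λ x → fib (suc k) + shiftᵏ k (x ∸ fib k)) m+1≡ ⟩
  fib (suc k) + shiftᵏ k (fib k ∸ fib k)    ≡⟨ cong (λ x → fib (suc k) + shiftᵏ k x) (n∸n≡0 (fib k)) ⟩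
  fib (suc k) + shiftᵏ k 0                  ≡⟨ cong (fib (suc k) +_) (shiftᵏ-0 k) ⟩
  fib (suc k) + 0                           ≡⟨ +-identityʳ _ ⟩
  fib (suc k)                               ∎
  where open ≡-Reasoning

shiftᵏ-suc : ∀ k {m} → suc m < fib k → shiftᵏ k (suc m) + digit₀ᵏ k m ≡ shiftᵏ k m + 2
shiftᵏ-suc zero (s≤s ())
shiftᵏ-suc (suc k) {m} m+1< with suc m <? fib k
... | yes m+1<′ = begin
  shiftᵏ (suc k) (suc m) + digit₀ᵏ (suc k) m    ≡⟨ cong₂ _+_ (shiftᵏ-< k m+1<′) (digit₀ᵏ-< k m<) ⟩
  shiftᵏ k (suc m) + digit₀ᵏ k m                ≡⟨ shiftᵏ-suc k m+1<′ ⟩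
  shiftᵏ k m + 2                                ≡⟨ cong (_+ 2) (sym (shiftᵏ-< k m<)) ⟩
  shiftᵏ (suc k) m + 2                          ∎
  where
  open ≡-Reasoning
  m< = <-trans (n<1+n m) m+1<′
... | no m+1≮ with m <? fib k
...   | yes m< = begin
  shiftᵏ (suc k) (suc m) + digit₀ᵏ (suc k) m    ≡⟨ cong₂ _+_ (shiftᵏ-fib k m+1≡) (digit₀ᵏ-< k m<) ⟩
  fib (suc k) + digit₀ᵏ k m                     ≡⟨ sym (shiftᵏ-max k m+1≡) ⟩
  shiftᵏ k m + 2                                ≡⟨ cong (_+ 2) (sym (shiftᵏ-< k m<)) ⟩
  shiftᵏ (suc k) m + 2                          ∎
  where
  open ≡-Reasoning
  m+1≡ : suc m ≡ fib k
  m+1≡ = ≤-antisym m< (≮⇒≥ m+1≮)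
shiftᵏ-suc (suc zero)    (s≤s (s≤s z≤n)) | no _ | no m≮ = ⊥-elim (m≮ (s≤s z≤n))
shiftᵏ-suc (suc (suc k)) {m} m+1<        | no _ | no m≮ = begin
  shiftᵏ (2 + k) (suc m) + digit₀ᵏ (2 + k) m
    ≡⟨ cong₂ _+_ (shiftᵏ-≥ (suc k) (≤-trans fib≤ (n≤1+n m))) (digit₀ᵏ-≥ k fib≤) ⟩
  F + shiftᵏ (suc k) (suc m ∸ fib (suc k)) + digit₀ᵏ (suc k) m′
    ≡⟨ cong (λ x → F + shiftᵏ (suc k) x + digit₀ᵏ (suc k) m′) (+-∸-assoc 1 fib≤) ⟩
  F + shiftᵏ (suc k) (suc m′) + digit₀ᵏ (suc k) m′
    ≡⟨ cong₂ (λ x y → F + x + y) (shiftᵏ-< k m′+1<) (digit₀ᵏ-< k m′<) ⟩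
  F + shiftᵏ k (suc m′) + digit₀ᵏ k m′
    ≡⟨ +-assoc F _ _ ⟩
  F + (shiftᵏ k (suc m′) + digit₀ᵏ k m′)
    ≡⟨ cong (F +_) (shiftᵏ-suc k m′+1<) ⟩
  F + (shiftᵏ k m′ + 2)
    ≡⟨ sym (+-assoc F _ 2) ⟩
  F + shiftᵏ k m′ + 2
    ≡⟨ cong (λ x → F + x + 2) (sym (shiftᵏ-< k m′<)) ⟩
  F + shiftᵏ (suc k) m′ + 2
    ≡⟨ cong (_+ 2) (sym (shiftᵏ-≥ (suc k) fib≤)) ⟩
  shiftᵏ (2 + k) m + 2
    ∎
  where
  open ≡-Reasoning
  F = fib (2 + k)
  fib≤ : fib (suc k) ≤ m
  fib≤ = ≮⇒≥ m≮
  m′ = m ∸ fib (suc k)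
  m′+1< : suc m′ < fib k
  m′+1< = +-cancelˡ-< (fib (suc k)) _ _
            (subst (_< fib (2 + k)) (trans (cong suc (sym (m+[n∸m]≡n fib≤))) (sym (+-suc (fib (suc k)) m′))) m+1<)
  m′< : m′ < fib k
  m′< = <-trans (n<1+n m′) m′+1<

countFibLe≤ : ∀ n m → countFibLe n m ≤ suc m
countFibLe≤ n zero with fib zero ≤? n
... | yes _ = ≤-refl
... | no  _ = z≤n
countFibLe≤ n (suc m) with fib (suc m) ≤? n
... | yes _ = s≤s (countFibLe≤ n m)
... | no  _ = m≤n⇒m≤1+n (countFibLe≤ n m)

countFibLe-cases : ∀ n m → countFibLe n m ≡ suc m ⊎ n < fib (countFibLe n m)
countFibLe-cases n zero with fib zero ≤? n
... | yes _    = inj₁ refl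
... | no  fib≰ = inj₂ (≰⇒> fib≰)
countFibLe-cases n (suc m) with fib (suc m) ≤? n | countFibLe-cases n m
... | yes _    | inj₁ ≡m+1 = inj₁ (cong suc ≡m+1)
... | yes fib≤ | inj₂ n<   = ⊥-elim (<⇒≱ (<-≤-trans n< (fib-mono (countFibLe≤ n m))) fib≤)
... | no  fib≰ | inj₁ ≡m+1 = inj₂ (subst (λ l → n < fib l) (sym ≡m+1) (≰⇒> fib≰))
... | no  _    | inj₂ n<   = inj₂ n<

n<fib-countFibLe : ∀ n → n < fib (countFibLe n n)
n<fib-countFibLe n with countFibLe-cases n n
... | inj₁ ≡n+1 = subst (λ l → n < fib l) (sym ≡n+1) (<-trans (n<1+n n) (k<fib (suc n)))
... | inj₂ n<   = n<

greedy-pad : ∀ j k {n} → n < fib k → greedy (j + k) n ≡ replicate j 0 ++ greedy k n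
greedy-pad zero    k n< = refl
greedy-pad (suc j) k n< =
  trans (greedy-< (j + k) (<-≤-trans n< (fib-mono (m≤n+m k j)))) (cong (0 ∷_) (greedy-pad j k n<))

module _ {A : Set} (f : List ℕ → A) (f-0∷ : ∀ u → f (0 ∷ u) ≡ f u) where

  private
    f-pad : ∀ j u → f (replicate j 0 ++ u) ≡ f u
    f-pad zero    u = refl
    f-pad (suc j) u = trans (f-0∷ (replicate j 0 ++ u)) (f-pad j u)

    f-greedy-widen : ∀ {k k′ n} → k ≤ k′ → n < fib k → f (greedy k′ n) ≡ f (greedy k n)
    f-greedy-widen {k} {k′} {n} k≤ n< = begin
      f (greedy k′ n)                           ≡⟨ cong (λ l → f (greedy l n)) (sym (m∸n+n≡m k≤)) ⟩
      f (greedy (k′ ∸ k + k) n)                 ≡⟨ cong f (greedy-pad (k′ ∸ k) k n<) ⟩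
      f (replicate (k′ ∸ k) 0 ++ greedy k n)    ≡⟨ f-pad (k′ ∸ k) (greedy k n) ⟩
      f (greedy k n)                            ∎
      where open ≡-Reasoning

  greedy≈repF : ∀ k {n} → n < fib k → f (greedy k n) ≡ f (repF n)
  greedy≈repF k {n} n< with ≤-total k (countFibLe n n)
  ... | inj₁ k≤ = sym (f-greedy-widen k≤ n<)
  ... | inj₂ ≥k = f-greedy-widen ≥k (n<fib-countFibLe n)

-- shift n = [rep_F(n)0] by val-∷ʳ; digit₀ n is the last digit of rep_F(n), 0 when it is empty.
shift : ℕ → ℕ
shift n = shiftedVal (repF n)

digit₀ : ℕ → ℕ
digit₀ n = lastDigit (repF n)

shiftᵏ≡shift : ∀ k {n} → n < fib k → shiftᵏ k n ≡ shift n
shiftᵏ≡shift = greedy≈repF shiftedVal (shiftedVal-∷ 0)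

digit₀ᵏ≡digit₀ : ∀ k {n} → n < fib k → digit₀ᵏ k n ≡ digit₀ n
digit₀ᵏ≡digit₀ = greedy≈repF lastDigit lastDigit-0∷

shift-suc : ∀ n → shift (suc n) + digit₀ n ≡ shift n + 2
shift-suc n = begin
  shift (suc n) + digit₀ n          ≡⟨ sym (cong₂ _+_ (shiftᵏ≡shift k n+1<) (digit₀ᵏ≡digit₀ k n<)) ⟩
  shiftᵏ k (suc n) + digit₀ᵏ k n    ≡⟨ shiftᵏ-suc k n+1< ⟩
  shiftᵏ k n + 2                    ≡⟨ cong (_+ 2) (shiftᵏ≡shift k n<) ⟩
  shift n + 2                       ∎
  where
  open ≡-Reasoning
  k = 2 + n
  n+1< : suc n < fib k
  n+1< = <-trans (n<1+n (suc n)) (k<fib k)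
  n< : n < fib k
  n< = <-trans (n<1+n n) n+1<

repF-Zeckendorf : ∀ n → Zeckendorf (repF n)
repF-Zeckendorf n = greedy-Zeckendorf (countFibLe n n) (n<fib-countFibLe n)

digit₀-val : ∀ {v} → Zeckendorf v → digit₀ (val v) ≡ lastDigit v
digit₀-val {v} z = trans (sym (digit₀ᵏ≡digit₀ (length v) (val<fib z))) (cong lastDigit (greedy-val z))

digit₀-shift : ∀ n → digit₀ (shift n) ≡ 0
digit₀-shift n = begin
  digit₀ (shift n)                   ≡⟨ cong digit₀ (sym (val-∷ʳ (repF n) 0)) ⟩
  digit₀ (val (repF n ++ 0 ∷ []))    ≡⟨ digit₀-val (Zeckendorf-∷ʳ0 (repF-Zeckendorf n)) ⟩
  lastDigit (repF n ++ 0 ∷ [])       ≡⟨ lastDigit-∷ʳ (repF n) 0 ⟩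
  0                                  ∎
  where open ≡-Reasoning

digit₀-suc-shift : ∀ n → digit₀ n ≡ 0 → digit₀ (suc (shift n)) ≡ 1
digit₀-suc-shift n n↦0 = begin
  digit₀ (suc (shift n))             ≡⟨ cong digit₀ (sym (val-∷ʳ (repF n) 1)) ⟩
  digit₀ (val (repF n ++ 1 ∷ []))    ≡⟨ digit₀-val (Zeckendorf-∷ʳ1 (repF-Zeckendorf n) n↦0) ⟩
  lastDigit (repF n ++ 1 ∷ [])       ≡⟨ lastDigit-∷ʳ (repF n) 1 ⟩
  1                                  ∎
  where open ≡-Reasoning

digit₀≡1 : ∀ n → EndsWith1 (repF n) → digit₀ n ≡ 1
digit₀≡1 n = cong (fromMaybe 0)

digit₀≡0 : ∀ n → ¬ EndsWith1 (repF n) → digit₀ n ≡ 0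
digit₀≡0 n = fromMaybe≢1 (last (repF n)) (lastDigit≤1 (repF-Zeckendorf n))
  where
  fromMaybe≢1 : ∀ (d : Maybe ℕ) → fromMaybe 0 d ≤ 1 → d ≢ just 1 → fromMaybe 0 d ≡ 0
  fromMaybe≢1 nothing              _        _  = refl
  fromMaybe≢1 (just zero)          _        _  = refl
  fromMaybe≢1 (just (suc zero))    _        ≢1 = ⊥-elim (≢1 refl)
  fromMaybe≢1 (just (suc (suc _))) (s≤s ()) _

fibonacciMorphism : ℕ → List ℕ
fibonacciMorphism zero    = 0 ∷ 1 ∷ []
fibonacciMorphism (suc _) = 0 ∷ []

lengthDigit : ∀ {k} → (Fin k → List (Fin k)) → Fin k → ℕ
lengthDigit μ x = 2 ∸ length (μ x)

module PhiMorphismCriterion {k} (μ : Fin k → List (Fin k)) {c d : Fin k} {ds : List (Fin k)}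
  (prolongable : μ c ≡ c ∷ d ∷ ds)
  (projects : ∀ x → map (lengthDigit μ) (μ x) ≡ fibonacciMorphism (lengthDigit μ x)) where

  digit : Fin k → ℕ
  digit = lengthDigit μ

  length-projects : ∀ x → length (μ x) ≡ length (fibonacciMorphism (2 ∸ length (μ x)))
  length-projects x = trans (sym (length-map digit (μ x))) (cong length (projects x))

  length+digit : ∀ x → length (μ x) + digit x ≡ 2
  length+digit x = lengths (length (μ x)) (length-projects x)
    where
    lengths : ∀ l → l ≡ length (fibonacciMorphism (2 ∸ l)) → l + (2 ∸ l) ≡ 2
    lengths 1 _ = refl
    lengths 2 _ = refl
    lengths 0 ()
    lengths (suc (suc (suc _))) ()

  nonErasing : ∀ x → 1 ≤ length (μ x)
  nonErasing x = subst (1 ≤_) (sym (length-projects x)) (nonEmpty (2 ∸ length (μ x)))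
    where
    nonEmpty : ∀ t → 1 ≤ length (fibonacciMorphism t)
    nonEmpty zero    = s≤s z≤n
    nonEmpty (suc _) = s≤s z≤n

  head-digit : ∀ {u} t → map digit u ≡ fibonacciMorphism t → digit (nth c u 0) ≡ 0
  head-digit {_ ∷ _} zero    eq = proj₁ (∷-injective eq)
  head-digit {_ ∷ _} (suc _) eq = proj₁ (∷-injective eq)

  second-digit : ∀ {u} t → map digit u ≡ fibonacciMorphism t → 1 < length u → digit (nth c u 1) ≡ 1
  second-digit {_ ∷ _ ∷ _} zero    eq _ = proj₁ (∷-injective (proj₂ (∷-injective eq)))
  second-digit {_ ∷ _ ∷ _} (suc _) eq _ with proj₂ (∷-injective eq)
  ... | ()
  second-digit {_ ∷ []} _ _ (s≤s ())

  open Prolongable μ prolongable nonErasing public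

  start≡shift-below : ∀ m → (∀ {j} → j < m → digit (w j) ≡ digit₀ j) → start m ≡ shift m
  start≡shift-below zero    _  = refl
  start≡shift-below (suc m) ih = +-cancelʳ-≡ (digit₀ m) _ _ (begin
    start m + length (μ (w m)) + digit₀ m
      ≡⟨ cong (start m + length (μ (w m)) +_) (sym (ih (n<1+n m))) ⟩
    start m + length (μ (w m)) + digit (w m)
      ≡⟨ +-assoc (start m) _ _ ⟩
    start m + (length (μ (w m)) + digit (w m))
      ≡⟨ cong₂ _+_ (start≡shift-below m (ih ∘ m<n⇒m<1+n)) (length+digit (w m)) ⟩
    shift m + 2
      ≡⟨ sym (shift-suc m) ⟩
    shift (suc m) + digit₀ m
      ∎)
    where open ≡-Reasoning

  digit-w : ∀ n → digit (w n) ≡ digit₀ n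
  digit-w = <-rec _ step
    where
    step : ∀ n → (∀ {j} → j < n → digit (w j) ≡ digit₀ j) → digit (w n) ≡ digit₀ n
    step n ih with decompose n
    ... | m , zero , refl , r< = begin
      digit (w (start m + 0))      ≡⟨ cong digit (selfSimilar m r<) ⟩
      digit (nth c (μ (w m)) 0)    ≡⟨ head-digit (digit (w m)) (projects (w m)) ⟩
      0                            ≡⟨ sym (digit₀-shift m) ⟩
      digit₀ (shift m)             ≡⟨ cong digit₀ (sym (trans (+-identityʳ (start m)) start≡)) ⟩
      digit₀ (start m + 0)         ∎
      where
      open ≡-Reasoning
      start≡ = start≡shift-below m (λ j< → ih (<-≤-trans j< (≤-trans (m≤start m) (m≤m+n _ 0))))
    ... | m , suc zero , refl , r< = begin
      digit (w (start m + 1))      ≡⟨ cong digit (selfSimilar m r<) ⟩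
      digit (nth c (μ (w m)) 1)    ≡⟨ second-digit (digit (w m)) (projects (w m)) r< ⟩
      1                            ≡⟨ sym (digit₀-suc-shift m (trans (sym (ih m<)) (m≤n⇒m∸n≡0 r<))) ⟩
      digit₀ (suc (shift m))       ≡⟨ cong digit₀ (sym (trans (+-comm (start m) 1) (cong suc start≡))) ⟩
      digit₀ (start m + 1)         ∎
      where
      open ≡-Reasoning
      m< : m < start m + 1
      m< = ≤-<-trans (m≤start m) (m<m+n (start m) (s≤s z≤n))
      start≡ = start≡shift-below m (λ j< → ih (<-trans j< m<))
    ... | m , suc (suc r) , refl , r< =
      ⊥-elim (<⇒≱ r< (≤-trans (m≤m+n _ (digit (w m))) (≤-trans (≤-reflexive (length+digit (w m))) (m≤m+n 2 r))))

  start≡shift : ∀ m → start m ≡ shift m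
  start≡shift m = start≡shift-below m (λ {j} _ → digit-w j)

  image-letter : ∀ n {i} → i < length (μ (w n)) → nth c (μ (w n)) i ≡ w (val (repF n ++ i ∷ []))
  image-letter n {i} i< = begin
    nth c (μ (w n)) i             ≡⟨ sym (selfSimilar n i<) ⟩
    w (start n + i)               ≡⟨ cong w (+-comm (start n) i) ⟩
    w (i + start n)               ≡⟨ cong w (cong₂ _+_ (sym (*-identityʳ i)) (start≡shift n)) ⟩
    w (i * 1 + shift n)           ≡⟨ cong w (sym (val-∷ʳ (repF n) i)) ⟩
    w (val (repF n ++ i ∷ []))    ∎
    where open ≡-Reasoning

  isPhiMorphism : IsPhiMorphism μ c
  isPhiMorphism n = short , long
    where
    length+digit₀ : length (μ (w n)) + digit₀ n ≡ 2
    length+digit₀ = trans (cong (length (μ (w n)) +_) (sym (digit-w n))) (length+digit (w n))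
    short : EndsWith1 (repF n) → μ (w n) ≡ w (val (repF n ++ 0 ∷ [])) ∷ []
    short ends1 = trans (length≡1 c (μ (w n)) length≡1′) (cong (_∷ []) (image-letter n (nonErasing (w n))))
      where
      length≡1′ : length (μ (w n)) ≡ 1
      length≡1′ = +-cancelʳ-≡ 1 _ _ (trans (cong (length (μ (w n)) +_) (sym (digit₀≡1 n ends1))) length+digit₀)
    long : ¬ EndsWith1 (repF n) → μ (w n) ≡ w (val (repF n ++ 0 ∷ [])) ∷ w (val (repF n ++ 1 ∷ [])) ∷ []
    long ¬ends1 = trans (length≡2 c (μ (w n)) length≡2′)
                        (cong₂ _∷_ (image-letter n (<-trans (s≤s z≤n) 1<)) (cong (_∷ []) (image-letter n 1<)))
      where
      length≡2′ : length (μ (w n)) ≡ 2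
      length≡2′ = trans (sym (+-identityʳ _))
                        (trans (cong (length (μ (w n)) +_) (sym (digit₀≡0 n ¬ends1))) length+digit₀)
      1< : 1 < length (μ (w n))
      1< = ≤-reflexive (sym length≡2′)

Move-sym : ∀ {x y x′ y′} → Move x y x′ y′ → Move y x y′ x′
Move-sym (inj₁ (x′< , refl))               = inj₂ (inj₁ (refl , x′<))
Move-sym (inj₂ (inj₁ (refl , y′<)))        = inj₁ (y′< , refl)
Move-sym (inj₂ (inj₂ (i , 1≤i , x≡ , y≡))) = inj₂ (inj₂ (i , 1≤i , y≡ , x≡))

Move-decreases : ∀ {x y x′ y′} → Move x y x′ y′ → x′ + y′ < x + y
Move-decreases {y = y} (inj₁ (x′< , refl))        = +-monoˡ-< y x′<
Move-decreases {x = x} (inj₂ (inj₁ (refl , y′<))) = +-monoʳ-< x y′<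
Move-decreases {x′ = x′} {y′} (inj₂ (inj₂ (i , 1≤i , refl , refl))) = +-mono-< (m<m+n x′ 1≤i) (m<m+n y′ 1≤i)

IsP-IsN-disjoint : ∀ {ℓ x y} → IsP ℓ x y → IsN ℓ x y → ⊥
IsP-IsN-disjoint (terminal x+y≤) (toP ℓ< _ _ _ _)      = <⇒≱ ℓ< x+y≤
IsP-IsN-disjoint (allToN _ toN)  (toP _ x′ y′ mv isP′) = IsP-IsN-disjoint isP′ (toN x′ y′ mv)

IsP-move : ∀ {ℓ x y x′ y′} → IsP ℓ x y → ℓ < x + y → Move x y x′ y′ → IsN ℓ x′ y′
IsP-move (terminal x+y≤) ℓ< _  = ⊥-elim (<⇒≱ ℓ< x+y≤)
IsP-move (allToN _ toN)  _  mv = toN _ _ mv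

strictlyIncreasing-injective : (f : ℕ → ℕ) → (∀ {m n} → m < n → f m < f n) → ∀ {m n} → f m ≡ f n → m ≡ n
strictlyIncreasing-injective f mono {m} {n} fm≡fn with <-cmp m n
... | tri< m<n _ _ = ⊥-elim (<⇒≢ (mono m<n) fm≡fn)
... | tri≈ _ m≡n _ = m≡n
... | tri> _ _ n<m = ⊥-elim (<⇒≢ (mono n<m) (sym fm≡fn))

module WythoffPairs (ℓ : ℕ) (A : ℕ → ℕ)
  (A-< : ∀ n → A n < A (suc n))
  (ℓ<A : ∀ n → ℓ < A n)
  (covers : ∀ x → ℓ < x → (∃[ n ] x ≡ A n) ⊎ (∃[ n ] x ≡ A n + n + suc ℓ))
  (disjoint : ∀ n m → A n ≢ A m + m + suc ℓ) where

  B : ℕ → ℕ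
  B n = A n + n + suc ℓ

  A-mono : ∀ {m n} → m < n → A m < A n
  A-mono {m} {suc n} m<1+n with m≤n⇒m<n∨m≡n (≤-pred m<1+n)
  ... | inj₁ m<n  = <-trans (A-mono m<n) (A-< n)
  ... | inj₂ refl = A-< m

  B-mono : ∀ {m n} → m < n → B m < B n
  B-mono m<n = +-monoˡ-< (suc ℓ) (+-mono-< (A-mono m<n) m<n)

  A-injective : ∀ {m n} → A m ≡ A n → m ≡ n
  A-injective = strictlyIncreasing-injective A A-mono

  B-injective : ∀ {m n} → B m ≡ B n → m ≡ n
  B-injective = strictlyIncreasing-injective B B-mono

  B≡A+gap : ∀ n → B n ≡ A n + (n + suc ℓ)
  B≡A+gap n = +-assoc (A n) n (suc ℓ)

  ℓ<gap : ∀ n → ℓ < n + suc ℓ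
  ℓ<gap n = m≤n+m (suc ℓ) n

  A<B : ∀ n → A n < B n
  A<B n = subst (A n <_) (sym (B≡A+gap n)) (m<m+n (A n) (≤-<-trans z≤n (ℓ<gap n)))

  Pair : ℕ → ℕ → Set
  Pair x y = ∃[ n ] ((x ≡ A n × y ≡ B n) ⊎ (x ≡ B n × y ≡ A n))

  Predicted : ℕ → ℕ → Set
  Predicted x y = x + y ≤ ℓ ⊎ Pair x y

  Pair-sym : ∀ {x y} → Pair x y → Pair y x
  Pair-sym (n , inj₁ (x≡ , y≡)) = n , inj₂ (y≡ , x≡)
  Pair-sym (n , inj₂ (x≡ , y≡)) = n , inj₁ (y≡ , x≡)

  Predicted-sym : ∀ {x y} → Predicted x y → Predicted y x
  Predicted-sym {x} {y} (inj₁ x+y≤) = inj₁ (subst (_≤ ℓ) (+-comm x y) x+y≤)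
  Predicted-sym         (inj₂ p)    = inj₂ (Pair-sym p)

  Pair-≤ : ∀ {x y} → Pair x y → x ≤ y → ∃[ n ] x ≡ A n × y ≡ B n
  Pair-≤ (n , inj₁ x,y≡)          _   = n , x,y≡
  Pair-≤ (n , inj₂ (refl , refl)) B≤A = ⊥-elim (<⇒≱ (A<B n) B≤A)

  ℓ<snd : ∀ {x y} → Pair x y → ℓ < y
  ℓ<snd (n , inj₁ (_ , refl)) = <-trans (ℓ<A n) (A<B n)
  ℓ<snd (n , inj₂ (_ , refl)) = ℓ<A n

  Pair-nonterminal : ∀ {x y} → Pair x y → ℓ < x + y
  Pair-nonterminal {x} {y} p = <-≤-trans (ℓ<snd p) (m≤n+m y x)

  Pair-functional : ∀ {x y y′} → Pair x y → Pair x y′ → y ≡ y′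
  Pair-functional (n , inj₁ (refl , refl)) (m , inj₁ (A≡A , refl)) = cong B (A-injective A≡A)
  Pair-functional (n , inj₁ (refl , _))    (m , inj₂ (A≡B , _))    = ⊥-elim (disjoint n m A≡B)
  Pair-functional (n , inj₂ (refl , _))    (m , inj₁ (B≡A , _))    = ⊥-elim (disjoint m n (sym B≡A))
  Pair-functional (n , inj₂ (refl , refl)) (m , inj₂ (B≡B , refl)) = cong A (B-injective B≡B)

  noMove-horizontal : ∀ {x y x′} → Pair x y → x′ < x → ¬ Predicted x′ y
  noMove-horizontal {y = y} {x′} p _ (inj₁ x′+y≤) = <⇒≱ (<-≤-trans (ℓ<snd p) (m≤n+m y x′)) x′+y≤
  noMove-horizontal p x′< (inj₂ q) = <⇒≢ x′< (Pair-functional (Pair-sym q) (Pair-sym p))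

  -- A diagonal move keeps the gap y − x, and the gap of a pair determines it.
  noMove-diagonal-≤ : ∀ {x′ y′ i} → Pair (x′ + i) (y′ + i) → 1 ≤ i → x′ ≤ y′ → ¬ Predicted x′ y′
  noMove-diagonal-≤ {x′} {y′} {i} p 1≤i x′≤y′ with Pair-≤ p (+-monoˡ-≤ i x′≤y′)
  ... | n , x′+i≡ , y′+i≡ = impossible
    where
    y′≡ : y′ ≡ x′ + (n + suc ℓ)
    y′≡ = +-cancelʳ-≡ i _ _ (begin
      y′ + i                    ≡⟨ y′+i≡ ⟩
      B n                       ≡⟨ B≡A+gap n ⟩
      A n + (n + suc ℓ)         ≡⟨ cong (_+ (n + suc ℓ)) (sym x′+i≡) ⟩
      x′ + i + (n + suc ℓ)      ≡⟨ rearrange x′ i (n + suc ℓ) ⟩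
      x′ + (n + suc ℓ) + i      ∎)
      where
      open ≡-Reasoning
      rearrange : ∀ x i g → x + i + g ≡ x + g + i
      rearrange = solve-∀
    impossible : ¬ Predicted x′ y′
    impossible (inj₁ x′+y′≤) =
      <⇒≱ (<-≤-trans (ℓ<gap n) (≤-trans (m≤n+m _ x′) (≤-trans (≤-reflexive (sym y′≡)) (m≤n+m y′ x′))))
          x′+y′≤
    impossible (inj₂ q) with Pair-≤ q x′≤y′
    ... | m , refl , y′≡B = <⇒≱ (m<m+n (A m) 1≤i) (≤-reflexive (trans x′+i≡ (cong A (sym m≡n))))
      where
      m≡n : m ≡ n
      m≡n = +-cancelʳ-≡ (suc ℓ) _ _ (+-cancelˡ-≡ (A m) _ _ (trans (sym (B≡A+gap m)) (trans (sym y′≡B) y′≡)))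

  noMove : ∀ {x y x′ y′} → Pair x y → Move x y x′ y′ → ¬ Predicted x′ y′
  noMove p (inj₁ (x′< , refl))        = noMove-horizontal p x′<
  noMove p (inj₂ (inj₁ (refl , y′<))) = noMove-horizontal (Pair-sym p) y′< ∘ Predicted-sym
  noMove {x′ = x′} {y′} p (inj₂ (inj₂ (i , 1≤i , refl , refl))) with ≤-total x′ y′
  ... | inj₁ x′≤y′ = noMove-diagonal-≤ p 1≤i x′≤y′
  ... | inj₂ y′≤x′ = noMove-diagonal-≤ (Pair-sym p) 1≤i y′≤x′ ∘ Predicted-sym

  MovesToPredicted : ℕ → ℕ → Set
  MovesToPredicted x y = ∃[ x′ ] ∃[ y′ ] Move x y x′ y′ × Predicted x′ y′

  -- The gap d = y − A n is smaller than that of the pair at A n: either d ≤ ℓ and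
  -- (0, d) is terminal, or d is the gap of an earlier pair (A m, B m).
  diagonal-escape : ∀ n {y} → A n ≤ y → y < B n → MovesToPredicted (A n) y
  diagonal-escape n {y} A≤y y<B with y ∸ A n ≤? ℓ
  ... | yes d≤ℓ =
    0 , y ∸ A n , inj₂ (inj₂ (A n , ≤-trans (s≤s z≤n) (ℓ<A n) , refl , sym (m∸n+n≡m A≤y))) , inj₁ d≤ℓ
  ... | no  d≰ℓ = A m , B m , inj₂ (inj₂ (i , m<n⇒0<n∸m Am<An , An≡ , y≡)) , inj₂ (m , inj₁ (refl , refl))
    where
    d = y ∸ A n
    m = d ∸ suc ℓ
    m+ℓ+1≡d : m + suc ℓ ≡ d
    m+ℓ+1≡d = m∸n+n≡m (≰⇒> d≰ℓ)
    y≡An+d : y ≡ A n + d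
    y≡An+d = sym (m+[n∸m]≡n A≤y)
    d< : d < n + suc ℓ
    d< = +-cancelˡ-< (A n) _ _ (subst₂ _<_ y≡An+d (B≡A+gap n) y<B)
    Am<An : A m < A n
    Am<An = A-mono (+-cancelʳ-< (suc ℓ) m n (subst (_< n + suc ℓ) (sym m+ℓ+1≡d) d<))
    i = A n ∸ A m
    An≡ : A n ≡ A m + i
    An≡ = sym (m+[n∸m]≡n (<⇒≤ Am<An))
    rearrange : ∀ a i m s → a + i + (m + s) ≡ a + m + s + i
    rearrange = solve-∀
    y≡ : y ≡ B m + i
    y≡ = trans y≡An+d (trans (cong₂ _+_ An≡ (sym m+ℓ+1≡d)) (rearrange (A m) i m (suc ℓ)))

  pair-or-escape-≤ : ∀ {x y} → x ≤ y → ℓ < x + y → Pair x y ⊎ MovesToPredicted x y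
  pair-or-escape-≤ {x} {y} x≤y ℓ< with x ≤? ℓ
  ... | yes x≤ℓ = inj₂ (x , ℓ ∸ x , inj₂ (inj₁ (refl , ℓ∸x<y)) , inj₁ (≤-reflexive (m+[n∸m]≡n x≤ℓ)))
    where
    ℓ∸x<y : ℓ ∸ x < y
    ℓ∸x<y = subst (ℓ ∸ x <_) (m+n∸m≡n x y) (∸-monoˡ-< ℓ< x≤ℓ)
  ... | no  x≰ℓ with covers x (≰⇒> x≰ℓ)
  ...   | inj₂ (n , refl) =
    inj₂ (B n , A n , inj₂ (inj₁ (refl , <-≤-trans (A<B n) x≤y)) , inj₂ (n , inj₂ (refl , refl)))
  ...   | inj₁ (n , refl) with <-cmp y (B n)
  ...     | tri< y<B _ _  = inj₂ (diagonal-escape n x≤y y<B)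
  ...     | tri≈ _ refl _ = inj₁ (n , inj₁ (refl , refl))
  ...     | tri> _ _ B<y  = inj₂ (A n , B n , inj₂ (inj₁ (refl , B<y)) , inj₂ (n , inj₁ (refl , refl)))

  pair-or-escape : ∀ x y → ℓ < x + y → Pair x y ⊎ MovesToPredicted x y
  pair-or-escape x y ℓ< with ≤-total x y
  ... | inj₁ x≤y = pair-or-escape-≤ x≤y ℓ<
  ... | inj₂ y≤x with pair-or-escape-≤ y≤x (subst (ℓ <_) (+-comm x y) ℓ<)
  ...   | inj₁ p                  = inj₁ (Pair-sym p)
  ...   | inj₂ (y′ , x′ , mv , q) = inj₂ (x′ , y′ , Move-sym mv , Predicted-sym q)

  predicted-classifies : ∀ N {x y} → x + y ≤ N
                         → (Predicted x y → IsP ℓ x y) × (¬ Predicted x y → IsN ℓ x y)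
  predicted-classifies zero x+y≤0 =
    (λ _ → terminal (≤-trans x+y≤0 z≤n)) , (λ ¬pred → ⊥-elim (¬pred (inj₁ (≤-trans x+y≤0 z≤n))))
  predicted-classifies (suc N) {x} {y} x+y≤ = isP , isN
    where
    ih : ∀ {x′ y′} → Move x y x′ y′
         → (Predicted x′ y′ → IsP ℓ x′ y′) × (¬ Predicted x′ y′ → IsN ℓ x′ y′)
    ih mv = predicted-classifies N (≤-pred (<-≤-trans (Move-decreases mv) x+y≤))
    isP : Predicted x y → IsP ℓ x y
    isP (inj₁ x+y≤ℓ) = terminal x+y≤ℓ
    isP (inj₂ p)     = allToN (Pair-nonterminal p) (λ x′ y′ mv → proj₂ (ih mv) (noMove p mv))
    isN : ¬ Predicted x y → IsN ℓ x y
    isN ¬pred with pair-or-escape x y (≰⇒> (¬pred ∘ inj₁))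
    ... | inj₁ p                  = ⊥-elim (¬pred (inj₂ p))
    ... | inj₂ (x′ , y′ , mv , q) = toP (≰⇒> (¬pred ∘ inj₁)) x′ y′ mv (proj₁ (ih mv) q)

  Predicted→IsP : ∀ {x y} → Predicted x y → IsP ℓ x y
  Predicted→IsP {x} {y} = proj₁ (predicted-classifies (x + y) ≤-refl)

  listing : IsPListing ℓ (λ n → A n , B n)
  listing = A-< , (λ n → A<B n , Pair-nonterminal (pair n) , Predicted→IsP (inj₂ (pair n))) , complete
    where
    pair : ∀ n → Pair (A n) (B n)
    pair n = n , inj₁ (refl , refl)
    complete : ∀ x y → x < y → NonTermP ℓ x y → ∃[ n ] (A n , B n) ≡ (x , y)
    complete x y x<y (ℓ< , isP) with pair-or-escape x y ℓ<
    ... | inj₁ p with Pair-≤ p (<⇒≤ x<y)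
    ...   | n , refl , refl = n , refl
    complete x y x<y (ℓ< , isP) | inj₂ (x′ , y′ , mv , q) =
      ⊥-elim (IsP-IsN-disjoint (Predicted→IsP q) (IsP-move isP ℓ< mv))

occurs : AB → AB → ℕ
occurs a a = 1
occurs b b = 1
occurs a b = 0
occurs b a = 0

occurs≡1 : ∀ {c e} → occurs c e ≡ 1 → e ≡ c
occurs≡1 {a} {a} _ = refl
occurs≡1 {b} {b} _ = refl

countBefore≡count : ∀ c k → countBefore c k ≡ count (occurs c ∘ gw) k
countBefore≡count c zero = refl
countBefore≡count c (suc k) with gw k ≟AB c
... | yes refl = trans (cong suc (countBefore≡count (gw k) k))
                       (trans (+-comm 1 _) (cong (count (occurs (gw k) ∘ gw) k +_) (sym (self (gw k)))))
  where
  self : ∀ e → occurs e e ≡ 1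
  self a = refl
  self b = refl
... | no  gw≢c = trans (countBefore≡count c k)
                       (trans (sym (+-identityʳ _)) (cong (count (occurs c ∘ gw) k +_) (sym (other c (gw k) gw≢c))))
  where
  other : ∀ c e → e ≢ c → occurs c e ≡ 0
  other a a a≢a = ⊥-elim (a≢a refl)
  other b b b≢b = ⊥-elim (b≢b refl)
  other a b _   = refl
  other b a _   = refl

f₂-projects : ∀ x → map (lengthDigit f₂) (f₂ x) ≡ fibonacciMorphism (lengthDigit f₂ x)
f₂-projects =
  from-yes (Fin.all? λ x → List.≡-dec _≟_ (map (lengthDigit f₂) (f₂ x)) (fibonacciMorphism (lengthDigit f₂ x)))

open PhiMorphismCriterion f₂ {c = # 0} {d = # 1} {ds = []} refl f₂-projects

-- Obtained by saturating {(0, 1, 2)} under the expansion step of factor₃-closure.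
factors₃ : List Factor₃
factors₃ =
  (# 0 , # 1 , # 2)    ∷ (# 1 , # 2 , # 3)    ∷ (# 2 , # 3 , # 4)    ∷ (# 3 , # 4 , # 5)    ∷
  (# 4 , # 5 , # 6)    ∷ (# 5 , # 6 , # 7)    ∷ (# 5 , # 6 , # 15)   ∷ (# 5 , # 8 , # 9)    ∷
  (# 6 , # 7 , # 8)    ∷ (# 6 , # 15 , # 10)  ∷ (# 7 , # 8 , # 9)    ∷ (# 8 , # 9 , # 10)   ∷
  (# 9 , # 10 , # 11)  ∷ (# 9 , # 10 , # 13)  ∷ (# 10 , # 11 , # 12) ∷ (# 10 , # 13 , # 5)  ∷
  (# 10 , # 13 , # 14) ∷ (# 11 , # 12 , # 10) ∷ (# 12 , # 10 , # 13) ∷ (# 13 , # 5 , # 6)   ∷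
  (# 13 , # 5 , # 8)   ∷ (# 13 , # 14 , # 10) ∷ (# 14 , # 10 , # 13) ∷ (# 15 , # 10 , # 13) ∷ []

_≟₃_ : DecidableEquality Factor₃
_≟₃_ = Product.≡-dec Fin._≟_ (Product.≡-dec Fin._≟_ Fin._≟_)

open import Data.List.Membership.DecPropositional _≟₃_ using (_∈_; _∈?_)

factor₃∈factors₃ : ∀ j → factor₃ j ∈ factors₃
factor₃∈factors₃ = factor₃-closure (_∈ factors₃) (here refl) closed
  where
  image₃ : Factor₃ → List (Fin 16)
  image₃ (x , y , z) = concatMap f₂ (x ∷ y ∷ z ∷ [])
  Closed : Factor₃ → Set
  Closed t = ∀ (r : Fin (length (f₂ (proj₁ t)))) → window₃ (image₃ t) (toℕ r) ∈ factors₃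
  closed? : ∀ t → Dec (Closed t)
  closed? t = Fin.all? λ r → window₃ (image₃ t) (toℕ r) ∈? factors₃
  allClosed : All.All Closed factors₃
  allClosed = from-yes (All.all? closed? factors₃)
  closed : ∀ {x y z} → (x , y , z) ∈ factors₃ → ∀ {r} → r < length (f₂ x)
           → window₃ (image₃ (x , y , z)) r ∈ factors₃
  closed {x} {y} {z} t∈ r< =
    subst (λ r → window₃ (image₃ (x , y , z)) r ∈ factors₃) (toℕ-fromℕ< r<) (All.lookup allClosed t∈ (fromℕ< r<))

everyFactor : (P : Factor₃ → Set) (P? : ∀ t → Dec (P t)) → {True (All.all? P? factors₃)} → ∀ j → P (factor₃ j)
everyFactor P P? {ok} j = All.lookup (toWitness ok) (factor₃∈factors₃ j)

isA : Fin 16 → ℕ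
isA x = occurs a (g₂ x)

isB : Fin 16 → ℕ
isB x = occurs b (g₂ x)

headIsB : Fin 16 → ℕ
headIsB x = isB (nth (# 0) (f₂ x) 0)

extra : Fin 16 → ℕ
extra x = length (f₂ x) ∸ 1

-- A potential on factors of length 2, chosen so that surplus-step telescopes (count-extra).
surplus : Fin 16 → Fin 16 → ℕ
surplus x y with toℕ x | toℕ y
... | 5  | 8  = 1
... | 7  | 8  = 1
... | 10 | 11 = 1
... | _  | _  = 0

b-heads : ∀ j → headIsB (w (2 + j)) ≡ isA (w j)
b-heads = everyFactor (λ (x , _ , z) → headIsB z ≡ isA x) (λ (x , _ , z) → headIsB z ≟ isA x)

surplus-step : ∀ j → surplus (w j) (w (1 + j)) + extra (w (2 + j)) ≡ isA (w (1 + j)) + surplus (w (1 + j)) (w (2 + j))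
surplus-step = everyFactor (λ (x , y , z) → surplus x y + extra z ≡ isA y + surplus y z)
                           (λ (x , y , z) → surplus x y + extra z ≟ isA y + surplus y z)

surplus-after-a : ∀ j → isA (w j) ≡ 1 → surplus (w j) (w (1 + j)) ≡ 0
surplus-after-a = everyFactor (λ (x , y , _) → isA x ≡ 1 → surplus x y ≡ 0)
                              (λ (x , y , _) → (isA x ≟ 1) →-dec (surplus x y ≟ 0))

b-then-a : ∀ j → gw j ≡ b → gw (1 + j) ≡ a
b-then-a = everyFactor (λ (x , y , _) → g₂ x ≡ b → g₂ y ≡ a)
                       (λ (x , y , _) → (g₂ x ≟AB b) →-dec (g₂ y ≟AB a))

b-only-heads : ∀ x → sum (map isB (f₂ x)) ≡ headIsB x
b-only-heads = from-yes (Fin.all? λ x → sum (map isB (f₂ x)) ≟ headIsB x)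

countA : ℕ → ℕ
countA = count (isA ∘ w)

countB : ℕ → ℕ
countB = count (isB ∘ w)

count-extra : ∀ k → count (extra ∘ w) (2 + k) ≡ countA (1 + k) + surplus (w k) (w (1 + k))
count-extra zero    = refl
count-extra (suc k) = begin
  count (extra ∘ w) (2 + k) + extra (w (2 + k))
    ≡⟨ cong (_+ extra (w (2 + k))) (count-extra k) ⟩
  countA (1 + k) + surplus (w k) (w (1 + k)) + extra (w (2 + k))
    ≡⟨ +-assoc (countA (1 + k)) _ _ ⟩
  countA (1 + k) + (surplus (w k) (w (1 + k)) + extra (w (2 + k)))
    ≡⟨ cong (countA (1 + k) +_) (surplus-step k) ⟩
  countA (1 + k) + (isA (w (1 + k)) + surplus (w (1 + k)) (w (2 + k)))
    ≡⟨ sym (+-assoc (countA (1 + k)) _ _) ⟩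
  countA (2 + k) + surplus (w (1 + k)) (w (2 + k))
    ∎
  where open ≡-Reasoning

count-headIsB : ∀ m → count (headIsB ∘ w) (2 + m) ≡ countA m
count-headIsB zero    = refl
count-headIsB (suc m) = cong₂ _+_ (count-headIsB m) (b-heads m)

countB-start : ∀ m → countB (start m) ≡ count (headIsB ∘ w) m
countB-start m = trans (count-images isB m) (count-cong m (λ {j} _ → b-only-heads (w j)))

afterA : AB → ℕ → ℕ
afterA a i = suc i
afterA b i = suc (suc i)

aIndex : ℕ → ℕ
aIndex zero    = 0
aIndex (suc n) = afterA (gw (suc (aIndex n))) (aIndex n)

afterA-spec : ∀ i e → gw (suc i) ≡ e → gw i ≡ a → gw (afterA e i) ≡ a × countA (afterA e i) ≡ suc (countA i)
afterA-spec i a next≡a i≡a = next≡a , trans (cong (λ e → countA i + occurs a e) i≡a) (+-comm _ 1)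
afterA-spec i b next≡b i≡a = b-then-a (suc i) next≡b ,
  trans (cong₂ (λ e e′ → countA i + occurs a e + occurs a e′) i≡a next≡b) (trans (+-identityʳ _) (+-comm _ 1))

aIndex-spec : ∀ n → gw (aIndex n) ≡ a × countA (aIndex n) ≡ n
aIndex-spec zero    = refl , refl
aIndex-spec (suc n) with afterA-spec (aIndex n) _ refl (proj₁ (aIndex-spec n))
... | gw≡a , count≡ = gw≡a , trans count≡ (cong suc (proj₂ (aIndex-spec n)))

aIndex-< : ∀ n → aIndex n < aIndex (suc n)
aIndex-< n = i<afterA (gw (suc (aIndex n))) (aIndex n)
  where
  i<afterA : ∀ e i → i < afterA e i
  i<afterA a i = n<1+n i
  i<afterA b i = <-trans (n<1+n i) (n<1+n (suc i))

bIndex : ℕ → ℕ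
bIndex n = aIndex n + n + 3

start≡bIndex : ∀ n → start (2 + aIndex n) ≡ bIndex n
start≡bIndex n = begin
  start (2 + k)
    ≡⟨ start≡+count (2 + k) ⟩
  2 + k + count (extra ∘ w) (2 + k)
    ≡⟨ cong (2 + k +_) (count-extra k) ⟩
  2 + k + (countA k + isA (w k) + surplus (w k) (w (1 + k)))
    ≡⟨ cong (λ c → 2 + k + (c + surplus (w k) (w (1 + k)))) (cong₂ _+_ (proj₂ (aIndex-spec n)) isA≡1) ⟩
  2 + k + (n + 1 + surplus (w k) (w (1 + k)))
    ≡⟨ cong (λ s → 2 + k + (n + 1 + s)) (surplus-after-a k isA≡1) ⟩
  2 + k + (n + 1 + 0)
    ≡⟨ rearrange k n ⟩
  k + n + 3
    ∎
  where
  open ≡-Reasoning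
  k = aIndex n
  isA≡1 : isA (w k) ≡ 1
  isA≡1 = cong (occurs a) (proj₁ (aIndex-spec n))
  rearrange : ∀ k n → 2 + k + (n + 1 + 0) ≡ k + n + 3
  rearrange = solve-∀

bIndex-spec : ∀ n → gw (bIndex n) ≡ b × countB (bIndex n) ≡ n
bIndex-spec n = subst (λ j → gw j ≡ b) (start≡bIndex n) head≡b
              , subst (λ j → countB j ≡ n) (start≡bIndex n) count≡
  where
  m = 2 + aIndex n
  head≡b : gw (start m) ≡ b
  head≡b = occurs≡1 (begin
    isB (w (start m))        ≡⟨ cong (isB ∘ w) (sym (+-identityʳ (start m))) ⟩
    isB (w (start m + 0))    ≡⟨ cong isB (selfSimilar m (nonErasing (w m))) ⟩
    headIsB (w m)            ≡⟨ b-heads (aIndex n) ⟩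
    isA (w (aIndex n))       ≡⟨ cong (occurs a) (proj₁ (aIndex-spec n)) ⟩
    1                        ∎)
    where open ≡-Reasoning
  count≡ : countB (start m) ≡ n
  count≡ = trans (countB-start m) (trans (count-headIsB (aIndex n)) (proj₂ (aIndex-spec n)))

aIndex-or-bIndex : ∀ j → (∃[ n ] j ≡ aIndex n) ⊎ (∃[ n ] j ≡ bIndex n)
aIndex-or-bIndex j with gw j in gw≡
... | a = inj₁ (n , count-injective (isA ∘ w) (cong (occurs a) gw≡) (cong (occurs a) (proj₁ (aIndex-spec n)))
                                     (sym (proj₂ (aIndex-spec n))))
  where n = countA j
... | b = inj₂ (n , count-injective (isB ∘ w) (cong (occurs b) gw≡) (cong (occurs b) (proj₁ (bIndex-spec n)))
                                     (sym (proj₂ (bIndex-spec n))))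
  where n = countB j

aIndex≢bIndex : ∀ n m → aIndex n ≢ bIndex m
aIndex≢bIndex n m a≡b = a≢b (trans (sym (proj₁ (aIndex-spec n))) (trans (cong gw a≡b) (proj₁ (bIndex-spec m))))
  where
  a≢b : a ≢ b
  a≢b ()

bIndex+3 : ∀ n → bIndex n + 3 ≡ aIndex n + 3 + n + 3
bIndex+3 n = rearrange (aIndex n) n
  where
  rearrange : ∀ i n → i + n + 3 + 3 ≡ i + 3 + n + 3
  rearrange = solve-∀

covers : ∀ x → 2 < x → (∃[ n ] x ≡ aIndex n + 3) ⊎ (∃[ n ] x ≡ aIndex n + 3 + n + 3)
covers x 3≤x with aIndex-or-bIndex (x ∸ 3)
... | inj₁ (n , x-3≡) = inj₁ (n , trans (sym (m∸n+n≡m 3≤x)) (cong (_+ 3) x-3≡))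
... | inj₂ (n , x-3≡) = inj₂ (n , trans (sym (m∸n+n≡m 3≤x)) (trans (cong (_+ 3) x-3≡) (bIndex+3 n)))

disjoint : ∀ n m → aIndex n + 3 ≢ aIndex m + 3 + m + 3
disjoint n m a≡b = aIndex≢bIndex n m (+-cancelʳ-≡ 3 _ _ (trans a≡b (sym (bIndex+3 m))))

module K² = WythoffPairs 2 (λ n → aIndex n + 3) (λ n → +-monoˡ-< 3 (aIndex-< n)) (λ n → m≤n+m 3 (aIndex n))
                         covers disjoint

proposition23 : IsPhiMorphism f₂ (# 0)
                × (Σ (ℕ → ℕ × ℕ) λ s → IsPListing 2 s
                     × (∀ n → NthOcc a n (proj₁ (s n)) × NthOcc b n (proj₂ (s n))))
proposition23 = isPhiMorphism , (λ n → aIndex n + 3 , K².B n) , K².listing , λ n → nthA n , nthB n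
  where
  nthA : ∀ n → NthOcc a n (aIndex n + 3)
  nthA n = aIndex n , refl , proj₁ (aIndex-spec n)
         , trans (countBefore≡count a (aIndex n)) (proj₂ (aIndex-spec n))
  nthB : ∀ n → NthOcc b n (aIndex n + 3 + n + 3)
  nthB n = bIndex n , sym (bIndex+3 n) , proj₁ (bIndex-spec n)
         , trans (countBefore≡count b (bIndex n)) (proj₂ (bIndex-spec n))
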